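{- Let $q \ge 5$ be a prime number, $s \in \mathbb{Z}_q^* \setminus \{1\}$ and $2 \le k \le q-1$. Let $\mathcal{A} = \{1,2,\dots,k-1\}$ and $\mathcal{B} = \{k,k+1,\dots,q-1\}$, viewed as sets of residue classes modulo $q$. Then neither $\mathcal{A}$ nor $\mathcal{B}$ is invariant under multiplication by $s$ (i.e. $s\mathcal{A} \neq \mathcal{A}$ and $s\mathcal{B} \neq \mathcal{B}$ in $\mathbb{Z}_q$). -}

module Defs where

open import Data.Nat using (ℕ; _*_; _≤_; _<_; NonZero)
open import Data.Nat.DivMod using (_%_)
open import Data.Product using (Σ; _×_; ∃-syntax)
open import Function.Bundles using (_⇔_)
open import Relation.Binary.PropositionalEquality using (_≡_)

-- Residue classes modulo q are represented by their canonical
-- representatives 0 ≤ x < q.  A set of residues is a predicate on ℕ,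
-- meaningful on the representatives 0 … q-1.

_·_mod_ : ℕ → (ℕ → Set) → (q : ℕ) → .{{NonZero q}} → ℕ → Set
(s · S mod q) x = ∃[ a ] (S a × (s * a) % q ≡ x)

SameResidueSet : (q : ℕ) → (ℕ → Set) → (ℕ → Set) → Set
SameResidueSet q S T = (x : ℕ) → x < q → (S x ⇔ T x)

𝒜 : ℕ → ℕ → Set
𝒜 k x = 1 ≤ x × x < k

ℬ : ℕ → ℕ → ℕ → Set
ℬ q k x = k ≤ x × x < q

-- Multiplication by s commutes with the negation x ↦ q − x of nonzero residues, and
-- ℬ = −{1, …, q−k}; so it suffices to show that no interval {1, …, m} with 1 ≤ m ≤ q−2 is
-- s-invariant.  Let a = ⌊m/s⌋ + 1, so that a ≤ m (as s ≥ 2) and m < s·a ≤ m + s.  If s·a < q,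
-- then a is mapped outside the interval.  Otherwise q − s ≤ m lies in the interval, so
-- q − s ≡ s·b with b ≤ m, and then q ∣ s·(b+1) with 0 < s, b+1 < q, contradicting primality.
module Submission where

open import Defs
open import Data.Nat using (ℕ; zero; suc; _+_; _*_; _≤_; _<_; _∸_; NonZero; >-nonZero; z≤n; s≤s; s≤s⁻¹)
open import Data.Nat.Properties
open import Data.Nat.DivMod
open import Data.Nat.Divisibility using (_∣_; divides; ∣⇒≤; m%n≡0⇒n∣m)
open import Data.Nat.Primality using (Prime; euclidsLemma)
open import Data.Product using (_×_; _,_; proj₁; proj₂)
open import Data.Empty using (⊥)
open import Data.Sum using ([_,_]′)
open import Function.Base using (_∘_)
open import Function.Bundles using (_⇔_; mk⇔; Equivalence)
open import Function.Construct.Composition using (_⇔-∘_)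
open import Function.Construct.Symmetry using (⇔-sym)
open import Relation.Nullary using (¬_; contradiction)
open import Relation.Binary.PropositionalEquality

prime∤m*n : ∀ {p m n} → Prime p → 0 < m → m < p → 0 < n → n < p → ¬ p ∣ m * n
prime∤m*n p-prime (s≤s _) m<p (s≤s _) n<p p∣m*n =
  [ <⇒≱ m<p ∘ ∣⇒≤ , <⇒≱ n<p ∘ ∣⇒≤ ]′ (euclidsLemma _ _ p-prime p∣m*n)

m%n≡0∧0<m<n+n⇒m≡n : ∀ {m n} .{{_ : NonZero n}} → m % n ≡ 0 → 0 < m → m < n + n → m ≡ n
m%n≡0∧0<m<n+n⇒m≡n {m} {n} m%n≡0 0<m m<n+n with m%n≡0⇒n∣m m n m%n≡0
... | divides zero m≡0 = contradiction m≡0 (m<n⇒n≢0 0<m)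
... | divides (suc zero) m≡n = trans m≡n (+-identityʳ n)
... | divides (suc (suc t)) m≡n+n+tn =
  contradiction (subst (n + n ≤_) (sym m≡n+n+tn) (+-monoʳ-≤ n (m≤m+n n (t * n)))) (<⇒≱ m<n+n)

[m*[n∸o]]%n≡n∸[m*o]%n : ∀ m {n o} .{{_ : NonZero n}} → o ≤ n → (m * o) % n ≢ 0 →
                         (m * (n ∸ o)) % n ≡ n ∸ (m * o) % n
[m*[n∸o]]%n≡n∸[m*o]%n m {n} {o} o≤n r≢0 = begin
  y           ≡⟨ m+n∸n≡m y r ⟨
  y + r ∸ r   ≡⟨ cong (_∸ r) y+r≡n ⟩
  n ∸ r       ∎
  where
  open ≡-Reasoning
  y = (m * (n ∸ o)) % n
  r = (m * o) % n
  y+r≡n : y + r ≡ n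
  y+r≡n = m%n≡0∧0<m<n+n⇒m≡n (begin
    (y + r) % n                ≡⟨ %-distribˡ-+ (m * (n ∸ o)) (m * o) n ⟨
    (m * (n ∸ o) + m * o) % n  ≡⟨ cong (_% n) (*-distribˡ-+ m (n ∸ o) o) ⟨
    (m * (n ∸ o + o)) % n      ≡⟨ cong (λ z → (m * z) % n) (m∸n+n≡m o≤n) ⟩
    (m * n) % n                ≡⟨ m*n%n≡0 m n ⟩
    0                          ∎)
    (≤-trans (n≢0⇒n>0 r≢0) (m≤n+m r y))
    (+-mono-< (m%n<n _ n) (m%n<n _ n))

m<n*[1+m/n] : ∀ m n .{{_ : NonZero n}} → m < n * suc (m / n)
m<n*[1+m/n] m n = subst (m <_) (*-comm (suc (m / n)) n) (begin-strict
  m                  ≡⟨ m≡m%n+[m/n]*n m n ⟩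
  m % n + m / n * n  <⟨ +-monoˡ-< (m / n * n) (m%n<n m n) ⟩
  n + m / n * n      ∎)
  where open ≤-Reasoning

n*[1+m/n]≤m+n : ∀ m n .{{_ : NonZero n}} → n * suc (m / n) ≤ m + n
n*[1+m/n]≤m+n m n = subst (_≤ m + n) (*-comm (suc (m / n)) n)
  (subst (n + m / n * n ≤_) (+-comm n m) (+-monoʳ-≤ n (m/n*n≤m m n)))

[m*n]%o≡o∸m⇒o∣m*[1+n] : ∀ m n {o} .{{_ : NonZero o}} → m < o → (m * n) % o ≡ o ∸ m → o ∣ m * suc n
[m*n]%o≡o∸m⇒o∣m*[1+n] m n {o} m<o mn≡o∸m = m%n≡0⇒n∣m _ o (begin
  (m * suc n) % o            ≡⟨ cong (_% o) (*-suc m n) ⟩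
  (m + m * n) % o            ≡⟨ %-distribˡ-+ m (m * n) o ⟩
  (m % o + (m * n) % o) % o  ≡⟨ cong₂ (λ u v → (u + v) % o) (m<n⇒m%n≡m m<o) mn≡o∸m ⟩
  (m + (o ∸ m)) % o          ≡⟨ cong (_% o) (m+[n∸m]≡n (<⇒≤ m<o)) ⟩
  o % o                      ≡⟨ n%n≡0 o ⟩
  0                          ∎)
  where open ≡-Reasoning

𝒜-not-invariant : ∀ {q s k} .{{_ : NonZero q}} → Prime q → 2 ≤ s → s < q → 2 ≤ k → k < q →
                  ¬ SameResidueSet q (s · 𝒜 k mod q) (𝒜 k)
𝒜-not-invariant {q} {s} {suc m} q-prime 2≤s s<q (s≤s 1≤m) k<q invariant =
  [ small-product , large-product ]′ (<-≤-connex (s * a) q)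
  where
  0<s : 0 < s
  0<s = ≤-trans (s≤s z≤n) 2≤s
  instance _ = >-nonZero 0<s
  a : ℕ
  a = suc (m / s)
  a∈𝒜 : 𝒜 (suc m) a
  a∈𝒜 = s≤s z≤n , s≤s (m/n<m m s 2≤s)
    where instance _ = >-nonZero 1≤m
  small-product : s * a < q → ⊥
  small-product sa<q = <⇒≱ (m<n*[1+m/n] m s) (s≤s⁻¹ (subst (_< suc m) (m<n⇒m%n≡m sa<q)
    (proj₂ (Equivalence.to (invariant _ (m%n<n _ q)) (a , a∈𝒜 , refl)))))
  q∸s∈𝒜 : q ≤ s * a → 𝒜 (suc m) (q ∸ s)
  q∸s∈𝒜 q≤sa = m<n⇒0<n∸m s<q , s≤s (m≤n+o⇒m∸n≤o q s
    (≤-trans q≤sa (subst (s * a ≤_) (+-comm m s) (n*[1+m/n]≤m+n m s))))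
  no-preimage : ¬ (s · 𝒜 (suc m) mod q) (q ∸ s)
  no-preimage (b , (_ , b<k) , sb≡q∸s) =
    prime∤m*n q-prime 0<s s<q (s≤s z≤n) (≤-<-trans b<k k<q) ([m*n]%o≡o∸m⇒o∣m*[1+n] s b s<q sb≡q∸s)
  large-product : q ≤ s * a → ⊥
  large-product q≤sa =
    no-preimage (Equivalence.from (invariant (q ∸ s) (∸-monoʳ-< 0<s (<⇒≤ s<q))) (q∸s∈𝒜 q≤sa))

module _ {q s} .{{_ : NonZero q}} (q-prime : Prime q) (0<s : 0 < s) (s<q : s < q) where

  [s*a]%q≢0 : ∀ {a} → 0 < a → a < q → (s * a) % q ≢ 0
  [s*a]%q≢0 0<a a<q = prime∤m*n q-prime 0<s s<q 0<a a<q ∘ m%n≡0⇒n∣m _ q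

  [s*[q∸a]]%q≡q∸[s*a]%q : ∀ {a} → 0 < a → a < q → (s * (q ∸ a)) % q ≡ q ∸ (s * a) % q
  [s*[q∸a]]%q≡q∸[s*a]%q 0<a a<q = [m*[n∸o]]%n≡n∸[m*o]%n s (<⇒≤ a<q) ([s*a]%q≢0 0<a a<q)

  module _ {S T : ℕ → Set}
           (S-bounds : ∀ {x} → S x → 0 < x × x < q) (T-bounds : ∀ {x} → T x → 0 < x × x < q)
           (T⇔−S : ∀ {x} → x < q → T x ⇔ S (q ∸ x)) where

    ·-negate : ∀ {y} → y ≤ q → (s · T mod q) y ⇔ (s · S mod q) (q ∸ y)
    ·-negate {y} y≤q = mk⇔ to from
      where
      to : (s · T mod q) y → (s · S mod q) (q ∸ y)
      to (a , Ta , sa≡y) with T-bounds Ta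
      ... | 0<a , a<q = q ∸ a , Equivalence.to (T⇔−S a<q) Ta ,
                        trans ([s*[q∸a]]%q≡q∸[s*a]%q 0<a a<q) (cong (q ∸_) sa≡y)
      from : (s · S mod q) (q ∸ y) → (s · T mod q) y
      from (b , Sb , sb≡q∸y) with S-bounds Sb
      ... | 0<b , b<q = q ∸ b ,
                        Equivalence.from (T⇔−S (∸-monoʳ-< 0<b (<⇒≤ b<q)))
                                         (subst S (sym (m∸[m∸n]≡n (<⇒≤ b<q))) Sb) ,
                        trans ([s*[q∸a]]%q≡q∸[s*a]%q 0<b b<q) (trans (cong (q ∸_) sb≡q∸y) (m∸[m∸n]≡n y≤q))

    invariant-negate : SameResidueSet q (s · S mod q) S → SameResidueSet q (s · T mod q) T
    invariant-negate _ zero _ =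
      mk⇔ (λ (a , Ta , sa≡0) → contradiction sa≡0 ([s*a]%q≢0 (proj₁ (T-bounds Ta)) (proj₂ (T-bounds Ta))))
          (λ T0 → contradiction (proj₁ (T-bounds T0)) λ ())
    invariant-negate invariant y@(suc _) y<q =
      ⇔-sym (T⇔−S y<q) ⇔-∘ (invariant (q ∸ y) (∸-monoʳ-< (s≤s z≤n) (<⇒≤ y<q)) ⇔-∘ ·-negate (<⇒≤ y<q))

𝒜[1+q∸k]⇔ℬ-negate : ∀ {q k x} → k ≤ q → x < q → 𝒜 (suc (q ∸ k)) x ⇔ ℬ q k (q ∸ x)
𝒜[1+q∸k]⇔ℬ-negate {q} {k} {x} k≤q x<q = mk⇔
  (λ (0<x , x≤q∸k) →
     m+n≤o⇒m≤o∸n k (subst (_≤ q) (+-comm x k) (m≤o∸n⇒m+n≤o x k≤q (s≤s⁻¹ x≤q∸k))) ,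
     ∸-monoʳ-< 0<x (<⇒≤ x<q))
  (λ (k≤q∸x , q∸x<q) →
     ∸-cancelʳ-< q∸x<q ,
     s≤s (m+n≤o⇒m≤o∸n x (subst (_≤ q) (+-comm k x) (m≤o∸n⇒m+n≤o k (<⇒≤ x<q) k≤q∸x))))

lemma3p5 : (q : ℕ) → .{{_ : NonZero q}} → Prime q → 5 ≤ q →
           (s : ℕ) → 1 ≤ s → s < q → s ≢ 1 →
           (k : ℕ) → 2 ≤ k → k ≤ q ∸ 1 →
           ¬ SameResidueSet q (s · 𝒜 k mod q) (𝒜 k) × ¬ SameResidueSet q (s · ℬ q k mod q) (ℬ q k)
lemma3p5 q q-prime _ s 1≤s s<q s≢1 k 2≤k k≤q∸1 =
  𝒜-not-invariant q-prime 2≤s s<q 2≤k k<q ,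
  𝒜-not-invariant q-prime 2≤s s<q (s≤s (m<n⇒0<n∸m k<q)) 1+q∸k<q ∘
    invariant-negate q-prime 1≤s s<q ℬ-bounds 𝒜-bounds (𝒜[1+q∸k]⇔ℬ-negate k≤q)
  where
  2≤s : 2 ≤ s
  2≤s = ≤∧≢⇒< 1≤s (s≢1 ∘ sym)
  k<q : k < q
  k<q = m≤pred[n]⇒suc[m]≤n k≤q∸1
  k≤q : k ≤ q
  k≤q = <⇒≤ k<q
  1+q∸k<q : suc (q ∸ k) < q
  1+q∸k<q = subst (_≤ q) (+-comm (q ∸ k) 2) (m≤o∸n⇒m+n≤o (q ∸ k) (≤-trans 2≤k k≤q) (∸-monoʳ-≤ q 2≤k))
  ℬ-bounds : ∀ {x} → ℬ q k x → 0 < x × x < q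
  ℬ-bounds (k≤x , x<q) = ≤-trans (≤-trans (s≤s z≤n) 2≤k) k≤x , x<q
  𝒜-bounds : ∀ {x} → 𝒜 (suc (q ∸ k)) x → 0 < x × x < q
  𝒜-bounds (0<x , x≤q∸k) = 0<x , ≤-<-trans (s≤s⁻¹ x≤q∸k) (∸-monoʳ-< (≤-trans (s≤s z≤n) 2≤k) k≤q)
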